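{- Let $n\ge2$ be an integer and suppose there exists a $2$-$(v,k,\lambda)$ design with $b$ blocks and replication number $r$ satisfying $(n-1)^2=\dfrac{kr}{r-\lambda}$. Then there exists a Latin regular rectangular design with parameters $v^*=vn$, $b^*=bn$, $r^*=r(n-1)$, $k^*=k(n-1)$, $\lambda_1^*=(n-2)r$, $\lambda_2^*=\lambda(n-1)$, $\lambda_3^*=\lambda(n-2)$, $m=v$, $n$.
   Context: A $2$-$(v,k,\lambda)$ design (BIBD) has $v$ treatments, $b$ blocks each of $k<v$ distinct treatments, each treatment in $r$ blocks, and any two distinct treatments together in $\lambda$ blocks. A rectangular design (RD) with parameters $v=mn,b,r,k,\lambda_1,\lambda_2,\lambda_3,m,n$ has its $mn$ treatments arranged in an $m\times n$ array, $b$ blocks of size $k$, replication $r$, and any two distinct treatments occur together in $\lambda_1$ blocks if in the same row, $\lambda_2$ if in the same column, $\lambda_3$ otherwise. It is Latin regular if $\theta_1=\theta_2>0$ and $\theta_3>0$, where $\theta_1=r-\lambda_1+(m-1)(\lambda_2-\lambda_3)$, $\theta_2=r-\lambda_2+(n-1)(\lambda_1-\lambda_3)$, $\theta_3=r-\lambda_1-\lambda_2+\lambda_3$. -}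

module Defs where

open import Data.Nat using (ℕ; zero; suc; _+_; _*_; _∸_; _<_)
open import Data.Integer as ℤ using (ℤ; +_)
open import Data.Bool using (Bool; true; false; if_then_else_; _∧_)
open import Data.Fin as Fin using (Fin; combine)
open import Data.Fin.Subset using (Subset; ∣_∣)
open import Data.Vec using (lookup)
open import Data.Product using (_×_)
open import Function using (_∘_)
open import Relation.Binary.PropositionalEquality using (_≡_; _≢_)

countF : ∀ {b} → (Fin b → Bool) → ℕ
countF {zero}  f = 0
countF {suc b} f = (if f Fin.zero then 1 else 0) + countF (f ∘ Fin.suc)

Design : ℕ → ℕ → Set
Design v b = Fin b → Subset v

record IsBIBD (v b r k lam : ℕ) (D : Design v b) : Set where
  field
    k<v       : k < v
    blockSize : ∀ j → ∣ D j ∣ ≡ k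
    replic    : ∀ i → countF (λ j → lookup (D j) i) ≡ r
    balance   : ∀ i i′ → i ≢ i′ → countF (λ j → lookup (D j) i ∧ lookup (D j) i′) ≡ lam

-- Rectangular design: treatments Fin (m * n), treatment (x , y) in row x,
-- column y of the m × n array is  combine x y.
cell : (m n : ℕ) → Fin m → Fin n → Fin (m * n)
cell m n x y = combine {m} {n} x y

record IsRD (m n b r k lam₁ lam₂ lam₃ : ℕ) (D : Design (m * n) b) : Set where
  field
    blockSize : ∀ j → ∣ D j ∣ ≡ k
    replic    : ∀ x y → countF (λ j → lookup (D j) (cell m n x y)) ≡ r
    sameRow   : ∀ x y y′ → y ≢ y′ →
                countF (λ j → lookup (D j) (cell m n x y) ∧ lookup (D j) (cell m n x y′)) ≡ lam₁
    sameCol   : ∀ x x′ y → x ≢ x′ →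
                countF (λ j → lookup (D j) (cell m n x y) ∧ lookup (D j) (cell m n x′ y)) ≡ lam₂
    other     : ∀ x x′ y y′ → x ≢ x′ → y ≢ y′ →
                countF (λ j → lookup (D j) (cell m n x y) ∧ lookup (D j) (cell m n x′ y′)) ≡ lam₃

θ₁ θ₂ θ₃ : (m n r lam₁ lam₂ lam₃ : ℕ) → ℤ
θ₁ m n r l₁ l₂ l₃ = (+ r ℤ.- + l₁) ℤ.+ (+ m ℤ.- + 1) ℤ.* (+ l₂ ℤ.- + l₃)
θ₂ m n r l₁ l₂ l₃ = (+ r ℤ.- + l₂) ℤ.+ (+ n ℤ.- + 1) ℤ.* (+ l₁ ℤ.- + l₃)
θ₃ m n r l₁ l₂ l₃ = ((+ r ℤ.- + l₁) ℤ.- + l₂) ℤ.+ + l₃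

LatinRegular : (m n r lam₁ lam₂ lam₃ : ℕ) → Set
LatinRegular m n r l₁ l₂ l₃ =
  (θ₁ m n r l₁ l₂ l₃ ≡ θ₂ m n r l₁ l₂ l₃) ×
  (+ 0 ℤ.< θ₁ m n r l₁ l₂ l₃) ×
  (+ 0 ℤ.< θ₃ m n r l₁ l₂ l₃)

-- Each block B of the BIBD becomes the n blocks B × ([n] ∖ {z}).  The number of blocks
-- containing a product of two predicates factorises into the two counts, so all RD
-- parameters are BIBD parameters times n − 1 or n − 2.  For Latin regularity,
-- θ₁ = r + (v − 1)λ = kr by double counting flags, θ₂ = (n − 1)²(r − λ) and θ₃ = r − λ;
-- the hypothesis is exactly θ₁ = θ₂.
module Submission where

open import Defs
open import Algebra.Bundles using (CommutativeMonoid)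
open import Algebra.Properties.CommutativeSemigroup using (interchange)
open import Data.Bool using (Bool; true; false; if_then_else_; not; _∧_; _∨_)
open import Data.Bool.Properties using (∧-idem; ∨-inverseʳ; ∧-inverseʳ; ∧-commutativeMonoid)
open import Data.Fin using (Fin; zero; suc; combine; quotient; remainder; _↑ˡ_; _↑ʳ_)
open import Data.Fin.Properties using (_≟_; remQuot-combine)
open import Data.Fin.Subset using (Subset; ∣_∣)
open import Data.Nat using (ℕ; zero; suc; _+_; _*_; _∸_; _^_; _≤_; _<_; s≤s)
open import Data.Nat.Properties
  using (+-identityʳ; +-assoc; *-comm; *-identityʳ; *-distribʳ-+; m+n∸m≡n; m≤m+n; <⇒≤; <-≤-trans;
         m<n⇒0<n; m<n⇒0<n∸m; +-commutativeSemigroup; +-*-semiring)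
open import Data.Product using (Σ; _×_; _,_)
open import Data.Vec using ([]; _∷_; lookup; tabulate)
open import Data.Vec.Properties using (lookup∘tabulate)
open import Function using (_∘_)
open import Relation.Binary.PropositionalEquality using (_≡_; _≢_; refl; sym; trans; cong; cong₂; subst; module ≡-Reasoning)
open import Relation.Nullary using (does; yes; no)
open import Relation.Nullary.Decidable using (dec-false)
open import Algebra.Properties.Semiring.Sum +-*-semiring using (sum-syntax; sum-cong-≗; ∑-comm; *-distribʳ-sum)

indicator : Bool → ℕ
indicator b = if b then 1 else 0

countF-cong : ∀ {n} {f g : Fin n → Bool} → (∀ i → f i ≡ g i) → countF f ≡ countF g
countF-cong {zero}  f≗g = refl
countF-cong {suc n} f≗g = cong₂ _+_ (cong indicator (f≗g zero)) (countF-cong (f≗g ∘ suc))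

countF-false : ∀ n → countF {n} (λ _ → false) ≡ 0
countF-false zero    = refl
countF-false (suc n) = countF-false n

countF-true : ∀ n → countF {n} (λ _ → true) ≡ n
countF-true zero    = refl
countF-true (suc n) = cong suc (countF-true n)

countF-∧ˡ : ∀ {n} a (f : Fin n → Bool) → countF (λ i → a ∧ f i) ≡ indicator a * countF f
countF-∧ˡ     true  f = sym (+-identityʳ _)
countF-∧ˡ {n} false f = countF-false n

countF-↑ : ∀ m {n} (f : Fin (m + n) → Bool) →
           countF f ≡ countF (λ i → f (i ↑ˡ n)) + countF (λ i → f (m ↑ʳ i))
countF-↑ zero    f = refl
countF-↑ (suc m) f =
  trans (cong (indicator (f zero) +_) (countF-↑ m (f ∘ suc))) (sym (+-assoc (indicator (f zero)) _ _))

countF-combine : ∀ {m n} (f : Fin m → Bool) (g : Fin n → Bool) {h : Fin (m * n) → Bool} →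
                 (∀ i j → h (combine i j) ≡ f i ∧ g j) → countF h ≡ countF f * countF g
countF-combine {zero}      f g h≡ = refl
countF-combine {suc m} {n} f g {h} h≡ = begin
  countF h
    ≡⟨ countF-↑ n h ⟩
  countF {n} (λ j → h (combine {suc m} zero j)) + countF {m * n} (λ t → h (n ↑ʳ t))
    ≡⟨ cong₂ _+_ (trans (countF-cong (h≡ zero)) (countF-∧ˡ (f zero) g))
                 (countF-combine {m} (f ∘ suc) g (h≡ ∘ suc)) ⟩
  indicator (f zero) * countF g + countF (f ∘ suc) * countF g
    ≡⟨ sym (*-distribʳ-+ (countF g) (indicator (f zero)) (countF (f ∘ suc))) ⟩
  countF f * countF g ∎
  where open ≡-Reasoning

countF-∨-∧ : ∀ {n} (f g : Fin n → Bool) →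
             countF (λ i → f i ∨ g i) + countF (λ i → f i ∧ g i) ≡ countF f + countF g
countF-∨-∧ {zero}  f g = refl
countF-∨-∧ {suc n} f g = begin
  (indicator (a ∨ c) + countF (λ i → f (suc i) ∨ g (suc i))) + (indicator (a ∧ c) + countF (λ i → f (suc i) ∧ g (suc i)))
    ≡⟨ +-interchange (indicator (a ∨ c)) _ (indicator (a ∧ c)) _ ⟩
  (indicator (a ∨ c) + indicator (a ∧ c)) + (countF (λ i → f (suc i) ∨ g (suc i)) + countF (λ i → f (suc i) ∧ g (suc i)))
    ≡⟨ cong₂ _+_ (indicator-∨-∧ a c) (countF-∨-∧ (f ∘ suc) (g ∘ suc)) ⟩
  (indicator a + indicator c) + (countF (f ∘ suc) + countF (g ∘ suc))
    ≡⟨ +-interchange (indicator a) (indicator c) (countF (f ∘ suc)) (countF (g ∘ suc)) ⟩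
  countF f + countF g ∎
  where
  open ≡-Reasoning
  a c : Bool
  a = f zero
  c = g zero
  +-interchange : ∀ w x y z → (w + x) + (y + z) ≡ (w + y) + (x + z)
  +-interchange = interchange +-commutativeSemigroup
  indicator-∨-∧ : ∀ a c → indicator (a ∨ c) + indicator (a ∧ c) ≡ indicator a + indicator c
  indicator-∨-∧ true  c = refl
  indicator-∨-∧ false c = +-identityʳ (indicator c)

countF-not : ∀ {n} (f : Fin n → Bool) → countF (λ i → not (f i)) ≡ n ∸ countF f
countF-not {n} f = begin
  countF (not ∘ f)                           ≡⟨ sym (m+n∸m≡n (countF f) _) ⟩
  countF f + countF (not ∘ f) ∸ countF f     ≡⟨ cong (_∸ countF f) partition ⟩
  n ∸ countF f                               ∎
  where
  open ≡-Reasoning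
  partition : countF f + countF (not ∘ f) ≡ n
  partition = begin
    countF f + countF (not ∘ f)
      ≡⟨ sym (countF-∨-∧ f (not ∘ f)) ⟩
    countF (λ i → f i ∨ not (f i)) + countF (λ i → f i ∧ not (f i))
      ≡⟨ cong₂ _+_ (trans (countF-cong (∨-inverseʳ ∘ f)) (countF-true n))
                   (trans (countF-cong (∧-inverseʳ ∘ f)) (countF-false n)) ⟩
    n + 0
      ≡⟨ +-identityʳ n ⟩
    n ∎

countF-≟ˡ : ∀ {n} (y : Fin n) → countF (λ z → does (z ≟ y)) ≡ 1
countF-≟ˡ {suc n} zero    = cong suc (countF-false n)
countF-≟ˡ         (suc y) = countF-≟ˡ y

countF-≟ʳ : ∀ {n} (z : Fin n) → countF (λ y → does (z ≟ y)) ≡ 1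
countF-≟ʳ {suc n} zero    = cong suc (countF-false n)
countF-≟ʳ         (suc z) = countF-≟ʳ z

countF-≢ˡ : ∀ {n} (y : Fin n) → countF (λ z → not (does (z ≟ y))) ≡ n ∸ 1
countF-≢ˡ {n} y = trans (countF-not (λ z → does (z ≟ y))) (cong (n ∸_) (countF-≟ˡ y))

countF-≢ʳ : ∀ {n} (z : Fin n) → countF (λ y → not (does (z ≟ y))) ≡ n ∸ 1
countF-≢ʳ {n} z = trans (countF-not (λ y → does (z ≟ y))) (cong (n ∸_) (countF-≟ʳ z))

countF-≢₂ : ∀ {n} {y y′ : Fin n} → y ≢ y′ →
            countF (λ z → not (does (z ≟ y)) ∧ not (does (z ≟ y′))) ≡ n ∸ 2
countF-≢₂ {n} {y} {y′} y≢y′ = begin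
  countF (λ z → not (does (z ≟ y)) ∧ not (does (z ≟ y′)))
    ≡⟨ countF-cong (λ z → not-∨ (does (z ≟ y)) _) ⟩
  countF (λ z → not (does (z ≟ y) ∨ does (z ≟ y′)))
    ≡⟨ countF-not (λ z → does (z ≟ y) ∨ does (z ≟ y′)) ⟩
  n ∸ countF (λ z → does (z ≟ y) ∨ does (z ≟ y′))
    ≡⟨ cong (n ∸_) either ⟩
  n ∸ 2 ∎
  where
  open ≡-Reasoning
  not-∨ : ∀ a c → not a ∧ not c ≡ not (a ∨ c)
  not-∨ true  c = refl
  not-∨ false c = refl
  disjoint : ∀ z → does (z ≟ y) ∧ does (z ≟ y′) ≡ false
  disjoint z with z ≟ y
  ... | yes refl = dec-false (z ≟ y′) y≢y′
  ... | no  _    = refl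
  either : countF (λ z → does (z ≟ y) ∨ does (z ≟ y′)) ≡ 2
  either = begin
    countF (λ z → does (z ≟ y) ∨ does (z ≟ y′))
      ≡⟨ sym (+-identityʳ _) ⟩
    countF (λ z → does (z ≟ y) ∨ does (z ≟ y′)) + 0
      ≡⟨ cong (countF (λ z → does (z ≟ y) ∨ does (z ≟ y′)) +_)
              (sym (trans (countF-cong disjoint) (countF-false n))) ⟩
    countF (λ z → does (z ≟ y) ∨ does (z ≟ y′)) + countF (λ z → does (z ≟ y) ∧ does (z ≟ y′))
      ≡⟨ countF-∨-∧ (λ z → does (z ≟ y)) (λ z → does (z ≟ y′)) ⟩
    countF (λ z → does (z ≟ y)) + countF (λ z → does (z ≟ y′))
      ≡⟨ cong₂ _+_ (countF-≟ˡ y) (countF-≟ˡ y′) ⟩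
    2 ∎

∣p∣≡countF : ∀ {n} (p : Subset n) → ∣ p ∣ ≡ countF (lookup p)
∣p∣≡countF []          = refl
∣p∣≡countF (true  ∷ p) = cong suc (∣p∣≡countF p)
∣p∣≡countF (false ∷ p) = ∣p∣≡countF p

countF≡∑ : ∀ {n} (f : Fin n → Bool) → countF f ≡ ∑[ i < n ] indicator (f i)
countF≡∑ {zero}  f = refl
countF≡∑ {suc n} f = cong (indicator (f zero) +_) (countF≡∑ (f ∘ suc))

∑-const : ∀ n c → ∑[ i < n ] c ≡ n * c
∑-const zero    c = refl
∑-const (suc n) c = cong (c +_) (∑-const n c)

∑-pairCount≡∑-blockSize : ∀ {v b} (D : Design v b) (i : Fin v) →
              ∑[ i′ < v ] countF (λ j → lookup (D j) i ∧ lookup (D j) i′)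
                ≡ ∑[ j < b ] (indicator (lookup (D j) i) * ∣ D j ∣)
∑-pairCount≡∑-blockSize {v} {b} D i = begin
  ∑[ i′ < v ] countF (λ j → lookup (D j) i ∧ lookup (D j) i′)
    ≡⟨ sum-cong-≗ (λ i′ → countF≡∑ (λ j → lookup (D j) i ∧ lookup (D j) i′)) ⟩
  ∑[ i′ < v ] ∑[ j < b ] indicator (lookup (D j) i ∧ lookup (D j) i′)
    ≡⟨ ∑-comm (λ i′ j → indicator (lookup (D j) i ∧ lookup (D j) i′)) ⟩
  ∑[ j < b ] ∑[ i′ < v ] indicator (lookup (D j) i ∧ lookup (D j) i′)
    ≡⟨ sum-cong-≗ (λ j → sym (countF≡∑ (λ i′ → lookup (D j) i ∧ lookup (D j) i′))) ⟩
  ∑[ j < b ] countF (λ i′ → lookup (D j) i ∧ lookup (D j) i′)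
    ≡⟨ sum-cong-≗ (λ j → trans (countF-∧ˡ (lookup (D j) i) (lookup (D j)))
                               (cong (indicator (lookup (D j) i) *_) (sym (∣p∣≡countF (D j))))) ⟩
  ∑[ j < b ] (indicator (lookup (D j) i) * ∣ D j ∣) ∎
  where open ≡-Reasoning

r+[v∸1]λ≡kr : ∀ {v′ b r k lam} {D : Design (suc v′) b} →
              IsBIBD (suc v′) b r k lam D → r + v′ * lam ≡ k * r
r+[v∸1]λ≡kr {v′} {b} {r} {k} {lam} {D} bibd = begin
  r + v′ * lam
    ≡⟨ sym (cong₂ _+_ (trans (countF-cong (λ j → ∧-idem (lookup (D j) zero))) (replic zero))
                      (trans (sum-cong-≗ (λ i′ → balance zero (suc i′) λ ())) (∑-const v′ lam))) ⟩
  ∑[ i′ < suc v′ ] countF (λ j → lookup (D j) zero ∧ lookup (D j) i′)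
    ≡⟨ ∑-pairCount≡∑-blockSize D zero ⟩
  ∑[ j < b ] (indicator (lookup (D j) zero) * ∣ D j ∣)
    ≡⟨ sum-cong-≗ (λ j → cong (indicator (lookup (D j) zero) *_) (blockSize j)) ⟩
  ∑[ j < b ] (indicator (lookup (D j) zero) * k)
    ≡⟨ sym (*-distribʳ-sum k (λ j → indicator (lookup (D j) zero))) ⟩
  (∑[ j < b ] indicator (lookup (D j) zero)) * k
    ≡⟨ cong (_* k) (trans (sym (countF≡∑ (λ j → lookup (D j) zero))) (replic zero)) ⟩
  r * k
    ≡⟨ *-comm r k ⟩
  k * r ∎
  where
  open ≡-Reasoning
  open IsBIBD bibd

productDesign : ∀ {v b} → Design v b → (n : ℕ) → Design (v * n) (b * n)
productDesign {v} {b} D n c =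
  tabulate λ t → lookup (D (quotient n c)) (quotient n t) ∧ not (does (remainder {b} n c ≟ remainder {v} n t))

lookup-productDesign : ∀ {v b} (D : Design v b) n c x y →
  lookup (productDesign D n c) (cell v n x y) ≡ lookup (D (quotient n c)) x ∧ not (does (remainder {b} n c ≟ y))
lookup-productDesign {v} {b} D n c x y = begin
  lookup (productDesign D n c) (cell v n x y)
    ≡⟨ lookup∘tabulate _ (cell v n x y) ⟩
  lookup (D (quotient n c)) (quotient n (cell v n x y)) ∧ not (does (remainder {b} n c ≟ remainder {v} n (cell v n x y)))
    ≡⟨ cong (λ (x′ , y′) → lookup (D (quotient n c)) x′ ∧ not (does (remainder {b} n c ≟ y′)))
            (remQuot-combine x y) ⟩
  lookup (D (quotient n c)) x ∧ not (does (remainder {b} n c ≟ y)) ∎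
  where open ≡-Reasoning

lookup-productDesign-combine : ∀ {v b} (D : Design v b) n j z x y →
  lookup (productDesign D n (combine j z)) (cell v n x y) ≡ lookup (D j) x ∧ not (does (z ≟ y))
lookup-productDesign-combine D n j z x y =
  trans (lookup-productDesign D n (combine j z) x y)
        (cong (λ (j′ , z′) → lookup (D j′) x ∧ not (does (z′ ≟ y))) (remQuot-combine j z))

module _ {v b : ℕ} (D : Design v b) (n : ℕ) where

  ∣productDesign∣ : ∀ c → ∣ productDesign D n c ∣ ≡ ∣ D (quotient n c) ∣ * (n ∸ 1)
  ∣productDesign∣ c = begin
    ∣ productDesign D n c ∣
      ≡⟨ ∣p∣≡countF (productDesign D n c) ⟩
    countF (lookup (productDesign D n c))
      ≡⟨ countF-combine (lookup (D (quotient n c))) (λ y → not (does (remainder {b} n c ≟ y)))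
                        (lookup-productDesign D n c) ⟩
    countF (lookup (D (quotient n c))) * countF (λ y → not (does (remainder {b} n c ≟ y)))
      ≡⟨ cong₂ _*_ (sym (∣p∣≡countF (D (quotient n c)))) (countF-≢ʳ (remainder {b} n c)) ⟩
    ∣ D (quotient n c) ∣ * (n ∸ 1) ∎
    where open ≡-Reasoning

  replication-productDesign : ∀ x y →
    countF (λ c → lookup (productDesign D n c) (cell v n x y)) ≡ countF (λ j → lookup (D j) x) * (n ∸ 1)
  replication-productDesign x y =
    trans (countF-combine (λ j → lookup (D j) x) (λ z → not (does (z ≟ y)))
                          (λ j z → lookup-productDesign-combine D n j z x y))
          (cong (countF (λ j → lookup (D j) x) *_) (countF-≢ˡ y))

  pairCount-productDesign : ∀ x x′ y y′ →
    countF (λ c → lookup (productDesign D n c) (cell v n x y) ∧ lookup (productDesign D n c) (cell v n x′ y′))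
      ≡ countF (λ j → lookup (D j) x ∧ lookup (D j) x′) * countF (λ z → not (does (z ≟ y)) ∧ not (does (z ≟ y′)))
  pairCount-productDesign x x′ y y′ =
    countF-combine (λ j → lookup (D j) x ∧ lookup (D j) x′) (λ z → not (does (z ≟ y)) ∧ not (does (z ≟ y′)))
      λ j z → trans (cong₂ _∧_ (lookup-productDesign-combine D n j z x y)
                               (lookup-productDesign-combine D n j z x′ y′))
                    (∧-interchange (lookup (D j) x) _ (lookup (D j) x′) _)
    where
    ∧-interchange : ∀ a b c d → (a ∧ b) ∧ (c ∧ d) ≡ (a ∧ c) ∧ (b ∧ d)
    ∧-interchange = interchange (CommutativeMonoid.commutativeSemigroup ∧-commutativeMonoid)

productDesign-isRD : ∀ {v b r k lam} {D : Design v b} (n : ℕ) → IsBIBD v b r k lam D →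
  IsRD v n (b * n) (r * (n ∸ 1)) (k * (n ∸ 1)) ((n ∸ 2) * r) (lam * (n ∸ 1)) (lam * (n ∸ 2)) (productDesign D n)
productDesign-isRD {r = r} {D = D} n bibd = record
  { blockSize = λ c → trans (∣productDesign∣ D n c) (cong (_* (n ∸ 1)) (blockSize (quotient n c)))
  ; replic    = λ x y → trans (replication-productDesign D n x y) (cong (_* (n ∸ 1)) (replic x))
  ; sameRow   = λ x y y′ y≢y′ → trans (pairCount-productDesign D n x x y y′)
      (trans (cong₂ _*_ (trans (countF-cong (λ j → ∧-idem (lookup (D j) x))) (replic x)) (countF-≢₂ y≢y′))
             (*-comm r (n ∸ 2)))
  ; sameCol   = λ x x′ y x≢x′ → trans (pairCount-productDesign D n x x′ y y)
      (cong₂ _*_ (balance x x′ x≢x′) (trans (countF-cong (λ z → ∧-idem (not (does (z ≟ y))))) (countF-≢ˡ y)))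
  ; other     = λ x x′ y y′ x≢x′ y≢y′ → trans (pairCount-productDesign D n x x′ y y′)
      (cong₂ _*_ (balance x x′ x≢x′) (countF-≢₂ y≢y′))
  }
  where open IsBIBD bibd

open import Data.Integer as ℤ using (ℤ; +_; +<+)
open import Data.Integer.Properties using (pos-+; pos-*; [+m]-[+n]≡m⊖n; ⊖-≥)
open import Data.Integer.Tactic.RingSolver using (solve-∀)

[+m]-[+n]≡+[m∸n] : ∀ {m n} → n ≤ m → + m ℤ.- + n ≡ + (m ∸ n)
[+m]-[+n]≡+[m∸n] {m} {n} n≤m = trans ([+m]-[+n]≡m⊖n m n) (⊖-≥ n≤m)

-- The θᵢ are unfolded below so that `rewrite pos-*` can reach the casts of the products;
-- what remains is a ring identity in ℤ.
θ₁-productDesign : ∀ v′ p r lam →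
  θ₁ (suc v′) (2 + p) (r * suc p) (p * r) (lam * suc p) (lam * p) ≡ + r ℤ.+ + v′ ℤ.* + lam
θ₁-productDesign v′ p r lam = unfolded
  where
  identity : ∀ r p v l →
    (r ℤ.* (+ 1 ℤ.+ p) ℤ.- p ℤ.* r) ℤ.+ ((+ 1 ℤ.+ v) ℤ.- + 1) ℤ.* (l ℤ.* (+ 1 ℤ.+ p) ℤ.- l ℤ.* p) ≡ r ℤ.+ v ℤ.* l
  identity = solve-∀
  unfolded : (+ (r * suc p) ℤ.- + (p * r)) ℤ.+ (+ suc v′ ℤ.- + 1) ℤ.* (+ (lam * suc p) ℤ.- + (lam * p))
             ≡ + r ℤ.+ + v′ ℤ.* + lam
  unfolded rewrite pos-* r (suc p) | pos-* p r | pos-* lam (suc p) | pos-* lam p = identity (+ r) (+ p) (+ v′) (+ lam)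

θ₂-productDesign : ∀ v′ p r lam →
  θ₂ (suc v′) (2 + p) (r * suc p) (p * r) (lam * suc p) (lam * p) ≡ + suc p ℤ.* + suc p ℤ.* (+ r ℤ.- + lam)
θ₂-productDesign v′ p r lam = unfolded
  where
  identity : ∀ r p l →
    (r ℤ.* (+ 1 ℤ.+ p) ℤ.- l ℤ.* (+ 1 ℤ.+ p)) ℤ.+ ((+ 1 ℤ.+ (+ 1 ℤ.+ p)) ℤ.- + 1) ℤ.* (p ℤ.* r ℤ.- l ℤ.* p)
      ≡ (+ 1 ℤ.+ p) ℤ.* (+ 1 ℤ.+ p) ℤ.* (r ℤ.- l)
  identity = solve-∀
  unfolded : (+ (r * suc p) ℤ.- + (lam * suc p)) ℤ.+ (+ suc (suc p) ℤ.- + 1) ℤ.* (+ (p * r) ℤ.- + (lam * p))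
             ≡ + suc p ℤ.* + suc p ℤ.* (+ r ℤ.- + lam)
  unfolded rewrite pos-* r (suc p) | pos-* p r | pos-* lam (suc p) | pos-* lam p = identity (+ r) (+ p) (+ lam)

θ₃-productDesign : ∀ v′ p r lam →
  θ₃ (suc v′) (2 + p) (r * suc p) (p * r) (lam * suc p) (lam * p) ≡ + r ℤ.- + lam
θ₃-productDesign v′ p r lam = unfolded
  where
  identity : ∀ r p l → ((r ℤ.* (+ 1 ℤ.+ p) ℤ.- p ℤ.* r) ℤ.- l ℤ.* (+ 1 ℤ.+ p)) ℤ.+ l ℤ.* p ≡ r ℤ.- l
  identity = solve-∀
  unfolded : ((+ (r * suc p) ℤ.- + (p * r)) ℤ.- + (lam * suc p)) ℤ.+ + (lam * p) ≡ + r ℤ.- + lam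
  unfolded rewrite pos-* r (suc p) | pos-* p r | pos-* lam (suc p) | pos-* lam p = identity (+ r) (+ p) (+ lam)

latinRegular-productDesign : ∀ v′ p r lam → lam < r → r + v′ * lam ≡ suc p ^ 2 * (r ∸ lam) →
  LatinRegular (suc v′) (2 + p) (r * suc p) (p * r) (lam * suc p) (lam * p)
latinRegular-productDesign v′ p r lam lam<r r+v′λ≡ = θ₁≡θ₂ , 0<θ₁ , 0<θ₃
  where
  Θ : (ℕ → ℕ → ℕ → ℕ → ℕ → ℕ → ℤ) → ℤ
  Θ θ = θ (suc v′) (2 + p) (r * suc p) (p * r) (lam * suc p) (lam * p)
  r-λ≡ : + r ℤ.- + lam ≡ + (r ∸ lam)
  r-λ≡ = [+m]-[+n]≡+[m∸n] (<⇒≤ lam<r)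
  θ₁≡ : Θ θ₁ ≡ + (r + v′ * lam)
  θ₁≡ = trans (θ₁-productDesign v′ p r lam) (sym (trans (pos-+ r (v′ * lam)) (cong (ℤ._+_ (+ r)) (pos-* v′ lam))))
  θ₂≡ : Θ θ₂ ≡ + (suc p ^ 2 * (r ∸ lam))
  θ₂≡ = begin
    Θ θ₂                                     ≡⟨ θ₂-productDesign v′ p r lam ⟩
    + suc p ℤ.* + suc p ℤ.* (+ r ℤ.- + lam)  ≡⟨ cong₂ ℤ._*_ (sym (pos-* (suc p) (suc p))) r-λ≡ ⟩
    + (suc p * suc p) ℤ.* + (r ∸ lam)        ≡⟨ sym (pos-* (suc p * suc p) (r ∸ lam)) ⟩
    + (suc p * suc p * (r ∸ lam))            ≡⟨ cong (λ m → + (suc p * m * (r ∸ lam))) (sym (*-identityʳ (suc p))) ⟩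
    + (suc p ^ 2 * (r ∸ lam))                ∎
    where open ≡-Reasoning
  θ₁≡θ₂ : Θ θ₁ ≡ Θ θ₂
  θ₁≡θ₂ = trans θ₁≡ (trans (cong +_ r+v′λ≡) (sym θ₂≡))
  0<θ₁ : + 0 ℤ.< Θ θ₁
  0<θ₁ = subst (+ 0 ℤ.<_) (sym θ₁≡) (+<+ (<-≤-trans (m<n⇒0<n lam<r) (m≤m+n r (v′ * lam))))
  0<θ₃ : + 0 ℤ.< Θ θ₃
  0<θ₃ = subst (+ 0 ℤ.<_) (sym (trans (θ₃-productDesign v′ p r lam) r-λ≡)) (+<+ (m<n⇒0<n∸m lam<r))

theorem5 : (n v b r k lam : ℕ) → 2 ≤ n →
    Σ (Design v b) (IsBIBD v b r k lam) →
    lam < r →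
    (n ∸ 1) ^ 2 * (r ∸ lam) ≡ k * r →
    Σ (Design (v * n) (b * n)) (λ D →
      IsRD v n (b * n) (r * (n ∸ 1)) (k * (n ∸ 1)) ((n ∸ 2) * r) (lam * (n ∸ 1)) (lam * (n ∸ 2)) D
      × LatinRegular v n (r * (n ∸ 1)) ((n ∸ 2) * r) (lam * (n ∸ 1)) (lam * (n ∸ 2)))
theorem5 zero          _        _ _ _ _   ()
theorem5 (suc zero)    _        _ _ _ _   (s≤s ())
theorem5 (suc (suc p)) zero     b r k lam _ (D , bibd) lam<r [n-1]²[r-λ]≡kr with () ← IsBIBD.k<v bibd
theorem5 (suc (suc p)) (suc v′) b r k lam _ (D , bibd) lam<r [n-1]²[r-λ]≡kr =
  productDesign D (2 + p) ,
  productDesign-isRD (2 + p) bibd ,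
  latinRegular-productDesign v′ p r lam lam<r (trans (r+[v∸1]λ≡kr bibd) (sym [n-1]²[r-λ]≡kr))
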